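{- Let $a,b,c,e\in\mathbb Z$ with $a\neq 0$ and $e>0$, and let $h_3(j)=aj^3+bj^2+cj+e$ for $j\in\mathbb Z_{\geq 0}$, where it is assumed that $h_3(j)\geq 0$ for all $j\geq 0$. Put $\alpha=a/e$, $\beta=b/e$, $\gamma=c/e$. If $b<0$ and $b^2\leq 3ac$, then $$15\alpha+7\beta+3\gamma\leq s_0(\alpha+\beta+\gamma),\qquad\text{where } s_0:=39+16\sqrt{3}.$$ -}

module Defs where

open import Data.Nat as ℕ using (ℕ)
open import Data.Integer as ℤ using (ℤ; +_; 0ℤ)
open import Data.Rational as ℚ using (ℚ; 0ℚ)
open import Data.Product using (_×_)
open import Data.Sum using (_⊎_)

h₃ : ℤ → ℤ → ℤ → ℤ → ℤ → ℤ
h₃ a b c e j = a ℤ.* (j ℤ.* j ℤ.* j) ℤ.+ b ℤ.* (j ℤ.* j) ℤ.+ c ℤ.* j ℤ.+ e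

_over_∶_ : (x e : ℤ) → 0ℤ ℤ.< e → ℚ
_over_∶_ x (+ ℕ.suc n) _ = x ℚ./ ℕ.suc n
_over_∶_ x (+ ℕ.zero) (ℤ.+<+ ())

-- d ≤ q·√3 for rationals d, q (the order of the real numbers, written out
-- over ℚ since there are no reals):
--   if q ≥ 0 :  d ≤ q√3  ⇔  d ≤ 0  or  d² ≤ 3q²
--   if q ≤ 0 :  d ≤ q√3  ⇔  d ≤ 0  and 3q² ≤ d²
_≤_√3 : ℚ → ℚ → Set
d ≤ q √3 =
    (0ℚ ℚ.≤ q × (d ℚ.≤ 0ℚ ⊎ d ℚ.* d ℚ.≤ ((+ 3) ℚ./ 1) ℚ.* (q ℚ.* q)))
  ⊎ (q ℚ.≤ 0ℚ × d ℚ.≤ 0ℚ × ((+ 3) ℚ./ 1) ℚ.* (q ℚ.* q) ℚ.≤ d ℚ.* d)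

-- x ≤ (p + q√3)·s   with p, q, x, s rational, i.e.  x − p·s ≤ (q·s)√3
_≤[_+_√3]·_ : ℚ → ℚ → ℚ → ℚ → Set
x ≤[ p + q √3]· s = (x ℚ.- p ℚ.* s) ≤ (q ℚ.* s) √3

{-# OPTIONS --safe #-}
module Submission where

-- Since b < 0 and b² ≤ 3ac we have ac > 0, and a, c cannot both be negative, for then
-- h₃(e) < 0; so a, c ≥ 0.  For weights s, t ≥ 0
-- with 3k² ≤ 4st, AM-GM gives (kb)² ≤ 3k²ac ≤ 4(sa)(tc) ≤ (sa + tc)², hence
-- sa + kb + tc ≥ 0.  The weights (s, k, t) = (1, 1, 1) and (6, 8, 9) give α + β + γ ≥ 0 and
-- 6α + 8β + 9γ ≥ 0, and 15α + 7β + 3γ − 39(α + β + γ) = −4(6α + 8β + 9γ) ≤ 0.  So the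
-- bound already holds with 39 in place of s₀, the term 16√3(α + β + γ) being nonnegative.

open import Defs
open import Data.Nat using (ℕ)
open import Data.Integer using (ℤ; +_; 0ℤ; _<_; _≤_; _*_)
open import Data.Rational using (ℚ; _/_; _+_) renaming (_*_ to _*ℚ_)
open import Relation.Binary.PropositionalEquality using (_≢_)

open import Data.Nat as ℕ using (zero; suc; z≤n)
import Data.Nat.Properties as ℕ
open import Data.Integer as ℤ using (-[1+_]; +[1+_]; +≤+; -≤+; +<+; _-_; -_)
import Data.Integer.Properties as ℤ
open import Data.Integer.Tactic.RingSolver using (solve-∀; solve)
open import Data.List using (_∷_; [])
open import Data.Rational as ℚ using (0ℚ; toℚᵘ; fromℚᵘ)
open import Data.Rational.Properties as ℚ
  using (toℚᵘ-injective; toℚᵘ-fromℚᵘ; toℚᵘ-homo-+; toℚᵘ-homo-*)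
import Data.Rational.Solver as ℚ-Solver
open import Data.Rational.Unnormalised as ℚᵘ using (mkℚᵘ; *≡*)
import Data.Rational.Unnormalised.Properties as ℚᵘ
open import Data.Product using (_×_; _,_)
open import Data.Sum using (inj₁)
open import Relation.Binary.PropositionalEquality as ≡ using (_≡_; refl; sym; cong; cong₂; subst; subst₂)

m*m≤n*n⇒m≤n : ∀ {m n} → m ℕ.* m ℕ.≤ n ℕ.* n → m ℕ.≤ n
m*m≤n*n⇒m≤n m*m≤n*n = ℕ.≮⇒≥ (λ n<m → ℕ.<⇒≱ (ℕ.*-mono-< n<m n<m) m*m≤n*n)

square-nonNeg : ∀ i → 0ℤ ≤ i * i
square-nonNeg (+ n)    = subst (0ℤ ≤_) (ℤ.pos-* n n) (+≤+ z≤n)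
square-nonNeg -[1+ n ] = +≤+ z≤n

square-cancel-≤ : ∀ {i j} → 0ℤ ≤ j → i * i ≤ j * j → i ≤ j
square-cancel-≤ { -[1+ _ ]} (+≤+ _) _ = -≤+
square-cancel-≤ {+ m} {+ n} _ i*i≤j*j =
  +≤+ (m*m≤n*n⇒m≤n (ℤ.drop‿+≤+ (subst₂ _≤_ (sym (ℤ.pos-* m m)) (sym (ℤ.pos-* n n)) i*i≤j*j)))

*-nonNeg : ∀ {i j} → 0ℤ ≤ i → 0ℤ ≤ j → 0ℤ ≤ i * j
*-nonNeg {+ m} {+ n} _ _ = subst (0ℤ ≤_) (ℤ.pos-* m n) (+≤+ z≤n)

am-gm : ∀ i j → + 4 * (i * j) ≤ (i ℤ.+ j) * (i ℤ.+ j)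
am-gm i j = begin
  + 4 * (i * j)                      ≡⟨ ℤ.+-identityʳ _ ⟨
  + 4 * (i * j) ℤ.+ 0ℤ                ≤⟨ ℤ.+-monoʳ-≤ (+ 4 * (i * j)) (square-nonNeg (i - j)) ⟩
  + 4 * (i * j) ℤ.+ (i - j) * (i - j) ≡⟨ solve (i ∷ j ∷ []) ⟩
  (i ℤ.+ j) * (i ℤ.+ j)               ∎
  where open ℤ.≤-Reasoning

discriminant-bound : ∀ {a b c} s k t → 0ℤ ≤ s → 0ℤ ≤ t → 0ℤ ≤ a → 0ℤ ≤ c →
                     + 3 * (k * k) ≤ + 4 * (s * t) → b * b ≤ + 3 * a * c →
                     0ℤ ≤ s * a ℤ.+ k * b ℤ.+ t * c
discriminant-bound {a} {b} {c} s k t 0≤s 0≤t 0≤a 0≤c 3k²≤4st b²≤3ac =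
  subst (0ℤ ≤_) rearrange (ℤ.i≤j⇒0≤j-i (square-cancel-≤ 0≤sa+tc squares))
  where
  open ℤ.≤-Reasoning
  0≤sa+tc : 0ℤ ≤ s * a ℤ.+ t * c
  0≤sa+tc = ℤ.+-mono-≤ (*-nonNeg 0≤s 0≤a) (*-nonNeg 0≤t 0≤c)
  squares : - (k * b) * - (k * b) ≤ (s * a ℤ.+ t * c) * (s * a ℤ.+ t * c)
  squares = begin
    - (k * b) * - (k * b)       ≡⟨ solve (k ∷ b ∷ []) ⟩
    (k * k) * (b * b)           ≤⟨ ℤ.*-monoˡ-≤-nonNeg (k * k) {{ℤ.nonNegative (square-nonNeg k)}} b²≤3ac ⟩
    (k * k) * (+ 3 * a * c)     ≡⟨ solve (k ∷ a ∷ c ∷ []) ⟩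
    + 3 * (k * k) * (a * c)     ≤⟨ ℤ.*-monoʳ-≤-nonNeg (a * c) {{ℤ.nonNegative (*-nonNeg 0≤a 0≤c)}} 3k²≤4st ⟩
    + 4 * (s * t) * (a * c)     ≡⟨ solve (s ∷ t ∷ a ∷ c ∷ []) ⟩
    + 4 * ((s * a) * (t * c))   ≤⟨ am-gm (s * a) (t * c) ⟩
    (s * a ℤ.+ t * c) * (s * a ℤ.+ t * c) ∎
  rearrange : s * a ℤ.+ t * c - - (k * b) ≡ s * a ℤ.+ k * b ℤ.+ t * c
  rearrange = solve (s ∷ a ∷ k ∷ b ∷ t ∷ c ∷ [])

fromℚᵘ-homo-+ : ∀ p q → fromℚᵘ (p ℚᵘ.+ q) ≡ fromℚᵘ p + fromℚᵘ q
fromℚᵘ-homo-+ p q = toℚᵘ-injective (begin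
  toℚᵘ (fromℚᵘ (p ℚᵘ.+ q))              ≈⟨ toℚᵘ-fromℚᵘ (p ℚᵘ.+ q) ⟩
  p ℚᵘ.+ q                               ≈⟨ ℚᵘ.+-cong (toℚᵘ-fromℚᵘ p) (toℚᵘ-fromℚᵘ q) ⟨
  toℚᵘ (fromℚᵘ p) ℚᵘ.+ toℚᵘ (fromℚᵘ q)  ≈⟨ toℚᵘ-homo-+ (fromℚᵘ p) (fromℚᵘ q) ⟨
  toℚᵘ (fromℚᵘ p + fromℚᵘ q)            ∎)
  where open ℚᵘ.≃-Reasoning

fromℚᵘ-homo-* : ∀ p q → fromℚᵘ (p ℚᵘ.* q) ≡ fromℚᵘ p *ℚ fromℚᵘ q
fromℚᵘ-homo-* p q = toℚᵘ-injective (begin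
  toℚᵘ (fromℚᵘ (p ℚᵘ.* q))              ≈⟨ toℚᵘ-fromℚᵘ (p ℚᵘ.* q) ⟩
  p ℚᵘ.* q                               ≈⟨ ℚᵘ.*-cong (toℚᵘ-fromℚᵘ p) (toℚᵘ-fromℚᵘ q) ⟨
  toℚᵘ (fromℚᵘ p) ℚᵘ.* toℚᵘ (fromℚᵘ q)  ≈⟨ toℚᵘ-homo-* (fromℚᵘ p) (fromℚᵘ q) ⟨
  toℚᵘ (fromℚᵘ p *ℚ fromℚᵘ q)           ∎)
  where open ℚᵘ.≃-Reasoning

/-distribʳ-+ : ∀ x y d .{{_ : ℕ.NonZero d}} → (x ℤ.+ y) / d ≡ x / d + y / d
/-distribʳ-+ x y (suc n) =
  ≡.trans (ℚ.fromℚᵘ-cong {mkℚᵘ (x ℤ.+ y) n} {mkℚᵘ x n ℚᵘ.+ mkℚᵘ y n} (*≡* cross))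
          (fromℚᵘ-homo-+ (mkℚᵘ x n) (mkℚᵘ y n))
  where
  D = + suc n
  cross : (x ℤ.+ y) * + (suc n ℕ.* suc n) ≡ (x * D ℤ.+ y * D) * D
  cross = ≡.trans (cong ((x ℤ.+ y) *_) (ℤ.pos-* (suc n) (suc n))) (reassociate x y D)
    where
    reassociate : ∀ x y d → (x ℤ.+ y) * (d * d) ≡ (x * d ℤ.+ y * d) * d
    reassociate = solve-∀

/-*ˡ : ∀ k x d .{{_ : ℕ.NonZero d}} → (k * x) / d ≡ (k / 1) *ℚ (x / d)
/-*ˡ k x (suc n) =
  ≡.trans (cong (λ m → (k * x) / suc m) (sym (ℕ.+-identityʳ n))) (fromℚᵘ-homo-* (mkℚᵘ k 0) (mkℚᵘ x n))

/-nonNeg : ∀ {x} d .{{_ : ℕ.NonZero d}} → 0ℤ ≤ x → 0ℚ ℚ.≤ x / d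
/-nonNeg d (+≤+ {n = m} _) = ℚ.nonNegative⁻¹ _ {{ℚ.normalize-nonNeg m d}}

/-linear : ∀ s k t a b c d .{{_ : ℕ.NonZero d}} →
           (s * a ℤ.+ k * b ℤ.+ t * c) / d ≡ (s / 1) *ℚ (a / d) + (k / 1) *ℚ (b / d) + (t / 1) *ℚ (c / d)
/-linear s k t a b c d = begin
  (s * a ℤ.+ k * b ℤ.+ t * c) / d          ≡⟨ /-distribʳ-+ (s * a ℤ.+ k * b) (t * c) d ⟩
  (s * a ℤ.+ k * b) / d + (t * c) / d       ≡⟨ cong (_+ (t * c) / d) (/-distribʳ-+ (s * a) (k * b) d) ⟩
  (s * a) / d + (k * b) / d + (t * c) / d   ≡⟨ cong₂ _+_ (cong₂ _+_ (/-*ˡ s a d) (/-*ˡ k b d)) (/-*ˡ t c d) ⟩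
  (s / 1) *ℚ (a / d) + (k / 1) *ℚ (b / d) + (t / 1) *ℚ (c / d) ∎
  where open ≡.≡-Reasoning

S₀-Bound : ℚ → ℚ → ℚ → Set
S₀-Bound α β γ = (((+ 15) / 1) *ℚ α + ((+ 7) / 1) *ℚ β + ((+ 3) / 1) *ℚ γ)
                   ≤[ ((+ 39) / 1) + ((+ 16) / 1) √3]· (α + β + γ)

nonNeg-forms⇒S₀-Bound : ∀ α β γ → 0ℚ ℚ.≤ α + β + γ →
                        0ℚ ℚ.≤ ((+ 6) / 1) *ℚ α + ((+ 8) / 1) *ℚ β + ((+ 9) / 1) *ℚ γ →
                        S₀-Bound α β γ
nonNeg-forms⇒S₀-Bound α β γ 0≤σ 0≤τ = inj₁ (0≤16σ , inj₁ (subst (ℚ._≤ 0ℚ) (sym excess≡-4τ) -4τ≤0))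
  where
  σ = α + β + γ
  τ = ((+ 6) / 1) *ℚ α + ((+ 8) / 1) *ℚ β + ((+ 9) / 1) *ℚ γ
  open ℚ-Solver.+-*-Solver using (_:+_; _:-_; _:*_; _:=_; con) renaming (solve to solve-ℚ)
  0≤16σ : 0ℚ ℚ.≤ ((+ 16) / 1) *ℚ σ
  0≤16σ = ℚ.nonNegative⁻¹ _ {{ℚ.nonNeg*nonNeg⇒nonNeg ((+ 16) / 1) σ {{ℚ.nonNegative 0≤σ}}}}
  -4τ≤0 : (-[1+ 3 ] / 1) *ℚ τ ℚ.≤ 0ℚ
  -4τ≤0 = ℚ.nonPositive⁻¹ _ {{ℚ.nonPos*nonNeg⇒nonPos (-[1+ 3 ] / 1) τ {{ℚ.nonNegative 0≤τ}}}}
  excess≡-4τ : ((+ 15) / 1) *ℚ α + ((+ 7) / 1) *ℚ β + ((+ 3) / 1) *ℚ γ ℚ.- ((+ 39) / 1) *ℚ σ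
             ≡ (-[1+ 3 ] / 1) *ℚ τ
  excess≡-4τ = solve-ℚ 3 (λ α β γ →
      con ((+ 15) / 1) :* α :+ con ((+ 7) / 1) :* β :+ con ((+ 3) / 1) :* γ :- con ((+ 39) / 1) :* (α :+ β :+ γ)
      := con (-[1+ 3 ] / 1) :* (con ((+ 6) / 1) :* α :+ con ((+ 8) / 1) :* β :+ con ((+ 9) / 1) :* γ))
    refl α β γ

discriminant⇒S₀-Bound : ∀ {a b c} d .{{_ : ℕ.NonZero d}} → 0ℤ ≤ a → 0ℤ ≤ c → b * b ≤ + 3 * a * c →
                        S₀-Bound (a / d) (b / d) (c / d)
discriminant⇒S₀-Bound {a} {b} {c} d 0≤a 0≤c b²≤3ac = nonNeg-forms⇒S₀-Bound (a / d) (b / d) (c / d)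
  (subst (0ℚ ℚ.≤_) unit-weights (weighted (+ 1) (+ 1) (+ 1) (+≤+ z≤n) (+≤+ z≤n) (+≤+ (ℕ.n≤1+n 3))))
  (weighted (+ 6) (+ 8) (+ 9) (+≤+ z≤n) (+≤+ z≤n) (+≤+ (ℕ.m≤m+n 192 24)))
  where
  weighted : ∀ s k t → 0ℤ ≤ s → 0ℤ ≤ t → + 3 * (k * k) ≤ + 4 * (s * t) →
             0ℚ ℚ.≤ (s / 1) *ℚ (a / d) + (k / 1) *ℚ (b / d) + (t / 1) *ℚ (c / d)
  weighted s k t 0≤s 0≤t 3k²≤4st = subst (0ℚ ℚ.≤_) (/-linear s k t a b c d)
    (/-nonNeg d (discriminant-bound s k t 0≤s 0≤t 0≤a 0≤c 3k²≤4st b²≤3ac))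
  unit-weights : (+ 1 / 1) *ℚ (a / d) + (+ 1 / 1) *ℚ (b / d) + (+ 1 / 1) *ℚ (c / d) ≡ a / d + b / d + c / d
  unit-weights = cong₂ _+_ (cong₂ _+_ (ℚ.*-identityˡ (a / d)) (ℚ.*-identityˡ (b / d))) (ℚ.*-identityˡ (c / d))

-- At j = e the constant term is absorbed: c e + e = (c + 1) e.
h₃-at-e : ∀ P Q M E → h₃ (- P) (- Q) (- (+ 1 ℤ.+ M)) E E ≡ - (E * (P * E * E ℤ.+ Q * E ℤ.+ M))
h₃-at-e = expanded
  where
  expanded : ∀ P Q M E → - P * (E * E * E) ℤ.+ - Q * (E * E) ℤ.+ - (+ 1 ℤ.+ M) * E ℤ.+ E
                         ≡ - (E * (P * E * E ℤ.+ Q * E ℤ.+ M))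
  expanded = solve-∀

coefficients-nonNeg : ∀ {a b c} n → (∀ j → 0ℤ ≤ h₃ a b c +[1+ n ] (+ j)) → b < 0ℤ → b * b ≤ + 3 * a * c →
                      0ℤ ≤ a × 0ℤ ≤ c
coefficients-nonNeg {+ _}       { -[1+ _ ]} {+ _}       _ _ _ _        = +≤+ z≤n , +≤+ z≤n
coefficients-nonNeg {+ zero}    { -[1+ _ ]} { -[1+ _ ]} _ _ _ (+≤+ ())
coefficients-nonNeg {+[1+ _ ]}  { -[1+ _ ]} { -[1+ _ ]} _ _ _ ()
coefficients-nonNeg { -[1+ p ]} { -[1+ q ]} {+ zero}    _ _ _ b²≤3ac
  with subst (-[1+ q ] * -[1+ q ] ≤_) (ℤ.*-zeroʳ (+ 3 * -[1+ p ])) b²≤3ac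
... | +≤+ ()
coefficients-nonNeg { -[1+ _ ]} { -[1+ _ ]} {+[1+ _ ]}  _ _ _ ()
coefficients-nonNeg { -[1+ p ]} { -[1+ q ]} { -[1+ m ]} n h₃≥0 _ _
  with subst (0ℤ ≤_) (h₃-at-e +[1+ p ] +[1+ q ] (+ m) +[1+ n ]) (h₃≥0 (suc n))
... | ()
coefficients-nonNeg {b = + _} _ _ (+<+ ()) _

lemma3p3 : (a b c e : ℤ) → a ≢ 0ℤ → (e>0 : 0ℤ < e)
    → (∀ (j : ℕ) → 0ℤ ≤ h₃ a b c e (+ j))
    → b < 0ℤ → b * b ≤ + 3 * a * c
    → let α = a over e ∶ e>0
          β = b over e ∶ e>0
          γ = c over e ∶ e>0
      in (((+ 15) / 1) *ℚ α + ((+ 7) / 1) *ℚ β + ((+ 3) / 1) *ℚ γ)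
           ≤[ ((+ 39) / 1) + ((+ 16) / 1) √3]· (α + β + γ)
lemma3p3 _ _ _ (+ zero)   _ (+<+ ()) _ _ _
lemma3p3 a b c +[1+ n ] _ _ h₃≥0 b<0 b²≤3ac =
  let 0≤a , 0≤c = coefficients-nonNeg n h₃≥0 b<0 b²≤3ac
  in discriminant⇒S₀-Bound {a} {b} {c} (suc n) 0≤a 0≤c b²≤3ac
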